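{- Let $L$ be a countable linear ordering. Then $(L,<,s,p)$ is homogeneous if and only if the colored linear ordering $\Phi(L)$ is homogeneous (in the language $(<,w,z,sw,\{c_n\}_{n\ge1})$).
   Context: A structure is homogeneous if every isomorphism between finitely generated substructures extends to an automorphism. For a linear ordering $L$, $s(x)$ is the immediate successor of $x$ if it exists and $x$ otherwise; $p(x)$ is the immediate predecessor of $x$ if it exists and $x$ otherwise. Write $x\sim_1 y$ if only finitely many elements lie between $x$ and $y$; the classes (1-blocks) are convex, each isomorphic to $\omega$, $\omega^*$, $\zeta$ or a finite $n\ge1$, and $L/\sim_1$ is linearly ordered by the induced order. $\Phi(L)$ is the ordering $L/\sim_1$ in which each block $[x]$ receives exactly one unary color: $w$ if $[x]\cong\omega$, $z$ if $[x]\cong\zeta$, $sw$ if $[x]\cong\omega^*$, and $c_n$ if $[x]\cong n$. -}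

module Defs where

open import Level using (0ℓ)
open import Data.Nat as ℕ using (ℕ; suc)
open import Data.Integer as ℤ using (ℤ)
open import Data.Fin as Fin using (Fin)
open import Data.List using (List)
open import Data.List.Membership.Propositional using (_∈_)
open import Data.Product using (Σ; ∃; _×_; _,_)
open import Data.Sum using (_⊎_)
open import Relation.Nullary using (¬_; yes; no)
open import Relation.Binary using (Rel)
open import Relation.Binary.PropositionalEquality using (_≡_)
open import Function.Definitions using (Injective)
open import Function.Bundles using (_⇔_)
open import Axiom.ExcludedMiddle using (ExcludedMiddle)

Countable : Set → Set
Countable A = Σ (A → ℕ) λ f → Injective _≡_ _≡_ f

OrderIso : {A : Set} (_<_ : Rel A 0ℓ) (B : A → Set) (T : Set) (_<T_ : Rel T 0ℓ) → Set
OrderIso {A} _<_ B T _<T_ =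
  Σ (T → A) λ g →
    (∀ t → B (g t)) ×
    (∀ a → B a → ∃ λ t → g t ≡ a) ×
    (∀ t t' → (t <T t') ⇔ (g t < g t'))

module LO {A : Set} (_<_ : Rel A 0ℓ) where

  Btw : A → A → A → Set
  Btw x y z = (x < z × z < y) ⊎ (y < z × z < x)

  FinitelyMany : (A → Set) → Set
  FinitelyMany P = Σ (List A) λ xs → ∀ z → P z → z ∈ xs

  _~₁_ : A → A → Set
  x ~₁ y = FinitelyMany (Btw x y)

  -- induced order on L/~₁ (on representatives)
  _<Φ_ : A → A → Set
  x <Φ y = x < y × ¬ (x ~₁ y)

  Block : A → A → Set
  Block x y = x ~₁ y

  _>ℕ_ : Rel ℕ 0ℓ
  m >ℕ n = n ℕ.< m

  colW colZ colSW : A → Set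
  colW  x = OrderIso _<_ (Block x) ℕ ℕ._<_
  colZ  x = OrderIso _<_ (Block x) ℤ ℤ._<_
  colSW x = OrderIso _<_ (Block x) ℕ _>ℕ_

  colC : ℕ → A → Set
  colC n x = OrderIso _<_ (Block x) (Fin n) Fin._<_

  IsImmSucc : A → A → Set
  IsImmSucc x y = x < y × (∀ z → ¬ (x < z × z < y))

  module WithEM (em : ExcludedMiddle 0ℓ) where

    s : A → A
    s x with em {∃ λ y → IsImmSucc x y}
    ... | yes (y , _) = y
    ... | no _ = x

    p : A → A
    p x with em {∃ λ y → IsImmSucc y x}
    ... | yes (y , _) = y
    ... | no _ = x

    data Reach (x : A) : A → Set where
      here  : Reach x x
      stepS : ∀ {y} → Reach x y → Reach x (s y)
      stepP : ∀ {y} → Reach x y → Reach x (p y)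

    -- the substructure generated by the finite list gs
    Gen : List A → A → Set
    Gen gs z = ∃ λ g → g ∈ gs × Reach g z

    PartIsoLSP : List A → List A → (A → A) → Set
    PartIsoLSP gs hs f =
      (∀ x → Gen gs x → Gen hs (f x)) ×
      (∀ y → Gen hs y → ∃ λ x → Gen gs x × f x ≡ y) ×
      (∀ x y → Gen gs x → Gen gs y → (x < y) ⇔ (f x < f y)) ×
      (∀ x → Gen gs x → f (s x) ≡ s (f x)) ×
      (∀ x → Gen gs x → f (p x) ≡ p (f x))

    AutLSP : (A → A) → Set
    AutLSP σ =
      Injective _≡_ _≡_ σ ×
      (∀ y → ∃ λ x → σ x ≡ y) ×
      (∀ x y → (x < y) ⇔ (σ x < σ y)) ×
      (∀ x → σ (s x) ≡ s (σ x)) ×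
      (∀ x → σ (p x) ≡ p (σ x))

    HomogeneousLSP : Set
    HomogeneousLSP =
      ∀ gs hs f → PartIsoLSP gs hs f →
        ∃ λ σ → AutLSP σ × (∀ x → Gen gs x → σ x ≡ f x)

  -- Φ(L) = L/~₁ with colours, represented on representatives modulo ~₁.

  InDom : List A → A → Set
  InDom xs z = ∃ λ x → x ∈ xs × z ~₁ x

  PartIsoΦ : List A → List A → (A → A) → Set
  PartIsoΦ xs ys f =
    (∀ z → InDom xs z → InDom ys (f z)) ×
    (∀ y → InDom ys y → ∃ λ z → InDom xs z × f z ~₁ y) ×
    (∀ z z' → InDom xs z → InDom xs z' → (z ~₁ z') ⇔ (f z ~₁ f z')) ×
    (∀ z z' → InDom xs z → InDom xs z' → (z <Φ z') ⇔ (f z <Φ f z')) ×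
    (∀ z → InDom xs z →
       (colW z ⇔ colW (f z)) × (colZ z ⇔ colZ (f z)) × (colSW z ⇔ colSW (f z)) ×
       (∀ n → colC (suc n) z ⇔ colC (suc n) (f z)))

  AutΦ : (A → A) → Set
  AutΦ σ =
    (∀ z z' → (z ~₁ z') ⇔ (σ z ~₁ σ z')) ×
    (∀ y → ∃ λ z → σ z ~₁ y) ×
    (∀ z z' → (z <Φ z') ⇔ (σ z <Φ σ z')) ×
    (∀ z →
       (colW z ⇔ colW (σ z)) × (colZ z ⇔ colZ (σ z)) × (colSW z ⇔ colSW (σ z)) ×
       (∀ n → colC (suc n) z ⇔ colC (suc n) (σ z)))

  HomogeneousΦ : Set
  HomogeneousΦ =
    ∀ xs ys f → PartIsoΦ xs ys f →
      ∃ λ σ → AutΦ σ × (∀ z → InDom xs z → σ z ~₁ f z)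

{-# OPTIONS --safe #-}

-- Inside a 1-block every element is reached from any other by finitely many steps
-- of s or p, so the substructure of (L,<,s,p) generated by a finite set is the union
-- of the blocks of its elements, and an isomorphism between such substructures is
-- an order isomorphism between finitely many blocks.  It therefore induces a
-- partial isomorphism of Φ(L) (block isomorphisms preserve the colour), and an
-- automorphism of (L,<,s,p) induces one of Φ(L).  Conversely every block has order
-- type ω, ζ, ω* or n, so blocks of the same colour are order isomorphic, and every
-- order isomorphism between blocks commutes with s and p.  Gluing such block
-- isomorphisms, chosen at canonical representatives, lifts partial isomorphisms
-- and automorphisms of Φ(L) to (L,<,s,p).  Each direction of the theorem transfers
-- the given partial isomorphism to the homogeneous structure, extends it there to an
-- automorphism and transfers that back.

module Submission where

open import Defs
open import Level using (0ℓ)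
open import Relation.Binary using (Rel; IsStrictTotalOrder)
open import Relation.Binary.PropositionalEquality using (_≡_)
open import Function.Bundles using (_⇔_)
open import Axiom.ExcludedMiddle using (ExcludedMiddle)

open import Relation.Binary.PropositionalEquality using (refl; sym; trans; cong; subst; subst₂)
open import Relation.Binary.Definitions using (Trichotomous; tri<; tri≈; tri>)
import Relation.Binary.Construct.Flip.EqAndOrd as Flip
open import Relation.Nullary using (¬_; yes; no)
open import Relation.Nullary.Negation using (contradiction)
open import Data.Empty using (⊥-elim)
open import Data.Unit using (⊤; tt)
open import Data.Product using (Σ; ∃; _×_; _,_; proj₁; proj₂)
import Data.Product as Product
open import Data.Sum using (_⊎_; inj₁; inj₂)
import Data.Sum as Sum
open import Data.Nat as ℕ using (ℕ; zero; suc; _+_; z≤n; s≤s)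
import Data.Nat.Properties as ℕₚ
open import Data.Nat.GeneralisedArithmetic using (iterate)
open import Data.Nat.Induction using (<-rec)
open import Data.Integer as ℤ using (ℤ; +_; -[1+_])
import Data.Integer.Properties as ℤₚ
open import Data.Fin as Fin using (Fin; toℕ; fromℕ<)
import Data.Fin.Properties as Finₚ
open import Data.List using (List; []; _∷_; _++_)
open import Data.List.Membership.Propositional using (_∈_)
open import Data.List.Membership.Propositional.Properties using (∈-++⁺ˡ; ∈-++⁺ʳ)
open import Data.List.Relation.Unary.Any using (here; there)
import Data.List.Relation.Unary.Any as Any
open import Function.Base using (flip; id; _∘_)
open import Function.Bundles using (mk⇔; Equivalence)
open Equivalence using (to; from)
import Function.Properties.Equivalence as ⇔

least-witness : ExcludedMiddle 0ℓ → (P : ℕ → Set) → ∀ {n} → P n →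
                ∃ λ k → P k × ∀ {j} → P j → k ℕ.≤ j
least-witness em P {n} = <-rec Least search n
  where
  Least : ℕ → Set
  Least n = P n → ∃ λ k → P k × ∀ {j} → P j → k ℕ.≤ j
  search : ∀ n → (∀ {m} → m ℕ.< n → Least m) → Least n
  search n below pn with em {∃ λ m → m ℕ.< n × P m}
  ... | yes (m , m<n , pm) = below m<n pm
  ... | no ∄ = n , pn , λ {j} pj → ℕₚ.≮⇒≥ λ j<n → ∄ (j , j<n , pj)

module Blocks {A : Set} {_<_ : Rel A 0ℓ} (sto : IsStrictTotalOrder _≡_ _<_) where
  open LO _<_
  open IsStrictTotalOrder sto renaming (trans to <-trans)
  private module Op = LO (flip _<_)

  Btw-irrefl : ∀ {x z} → ¬ Btw x x z
  Btw-irrefl (inj₁ (x<z , z<x)) = asym x<z z<x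
  Btw-irrefl (inj₂ (x<z , z<x)) = asym x<z z<x

  Btw-split : ∀ {x y z w} → Btw x z w → Btw x y w ⊎ Btw y z w ⊎ w ≡ y
  Btw-split {y = y} {w = w} b with compare w y
  Btw-split (inj₁ (x<w , w<z)) | tri< w<y _ _ = inj₁ (inj₁ (x<w , w<y))
  Btw-split (inj₂ (z<w , w<x)) | tri< w<y _ _ = inj₂ (inj₁ (inj₂ (z<w , w<y)))
  Btw-split _                  | tri≈ _ w≡y _ = inj₂ (inj₂ w≡y)
  Btw-split (inj₁ (x<w , w<z)) | tri> _ _ y<w = inj₂ (inj₁ (inj₁ (y<w , w<z)))
  Btw-split (inj₂ (z<w , w<x)) | tri> _ _ y<w = inj₁ (inj₂ (y<w , w<x))

  ~₁-refl : ∀ {x} → x ~₁ x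
  ~₁-refl = [] , λ _ b → ⊥-elim (Btw-irrefl b)

  ~₁-reflexive : ∀ {x y} → x ≡ y → x ~₁ y
  ~₁-reflexive refl = ~₁-refl

  ~₁-sym : ∀ {x y} → x ~₁ y → y ~₁ x
  ~₁-sym (xs , cover) = xs , λ z b → cover z (Sum.swap b)

  ~₁-trans : ∀ {x y z} → x ~₁ y → y ~₁ z → x ~₁ z
  ~₁-trans {y = y} (xs , coverˡ) (ys , coverʳ) = xs ++ y ∷ ys , cover
    where
    cover : ∀ w → _ → w ∈ xs ++ y ∷ ys
    cover w b with Btw-split {y = y} b
    ... | inj₁ bˡ = ∈-++⁺ˡ (coverˡ w bˡ)
    ... | inj₂ (inj₁ bʳ) = ∈-++⁺ʳ xs (there (coverʳ w bʳ))
    ... | inj₂ (inj₂ w≡y) = ∈-++⁺ʳ xs (here w≡y)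

  ~₁-convex : ∀ {a b c} → a < b → b < c → a ~₁ c → a ~₁ b × b ~₁ c
  ~₁-convex {a} {b} {c} a<b b<c (xs , cover) = (xs , left) , (xs , right)
    where
    left : ∀ w → Btw a b w → w ∈ xs
    left w (inj₁ (a<w , w<b)) = cover w (inj₁ (a<w , <-trans w<b b<c))
    left w (inj₂ (b<w , w<a)) = ⊥-elim (asym a<b (<-trans b<w w<a))
    right : ∀ w → Btw b c w → w ∈ xs
    right w (inj₁ (b<w , w<c)) = cover w (inj₁ (<-trans a<b b<w , w<c))
    right w (inj₂ (c<w , w<b)) = ⊥-elim (asym b<c (<-trans c<w w<b))

  ~₁ᵒᵖ⇔~₁ : ∀ {x y} → (x Op.~₁ y) ⇔ (x ~₁ y)
  ~₁ᵒᵖ⇔~₁ = mk⇔ (Product.map₂ λ cover z → cover z ∘ flipBtw)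
                (Product.map₂ λ cover z → cover z ∘ flipBtw)
    where
    flipBtw : ∀ {P Q R S : Set} → (P × Q) ⊎ (R × S) → (S × R) ⊎ (Q × P)
    flipBtw = Sum.swap ∘ Sum.map Product.swap Product.swap

  immSucc⇒~₁ : ∀ {x y} → IsImmSucc x y → x ~₁ y
  immSucc⇒~₁ (x<y , gap) = [] , λ where
    z (inj₁ x<z<y) → ⊥-elim (gap z x<z<y)
    z (inj₂ (y<z , z<x)) → ⊥-elim (asym x<y (<-trans y<z z<x))

  immSucc-unique : ∀ {x y y'} → IsImmSucc x y → IsImmSucc x y' → y ≡ y'
  immSucc-unique {y = y} {y'} (x<y , gap) (x<y' , gap') with compare y y'
  ... | tri< y<y' _ _ = ⊥-elim (gap' y (x<y , y<y'))
  ... | tri≈ _ y≡y' _ = y≡y'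
  ... | tri> _ _ y'<y = ⊥-elim (gap y' (x<y' , y'<y))

  immSuccᵒᵖ⇔immSucc : ∀ {x y} → Op.IsImmSucc x y ⇔ IsImmSucc y x
  immSuccᵒᵖ⇔immSucc = mk⇔ (Product.map₂ λ gap z → gap z ∘ Product.swap)
                          (Product.map₂ λ gap z → gap z ∘ Product.swap)

  <Φ-resp-~₁ : ∀ {x y x' y'} → x ~₁ x' → y ~₁ y' → x <Φ y → x' <Φ y'
  <Φ-resp-~₁ {x} {y} {x'} {y'} x~x' y~y' (x<y , x≁y) =
    x'<y' , λ x'~y' → x≁y (~₁-trans x~x' (~₁-trans x'~y' (~₁-sym y~y')))
    where
    x'<y' : x' < y'
    x'<y' with compare x' y'
    ... | tri< x'<y' _ _ = x'<y'
    ... | tri≈ _ refl _ = ⊥-elim (x≁y (~₁-trans x~x' (~₁-sym y~y')))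
    ... | tri> _ _ y'<x' with compare y x'
    ...   | tri< y<x' _ _ = ⊥-elim (x≁y (proj₁ (~₁-convex x<y y<x' x~x')))
    ...   | tri≈ _ refl _ = ⊥-elim (x≁y x~x')
    ...   | tri> _ _ x'<y = ⊥-elim (x≁y (~₁-trans x~x' (proj₂ (~₁-convex y'<x' x'<y (~₁-sym y~y')))))

  <Φ-cong : ∀ {x y x' y'} → x ~₁ x' → y ~₁ y' → (x <Φ y) ⇔ (x' <Φ y')
  <Φ-cong x~x' y~y' = mk⇔ (<Φ-resp-~₁ x~x' y~y') (<Φ-resp-~₁ (~₁-sym x~x') (~₁-sym y~y'))

  <Φ⇔< : ∀ {x y} → ¬ x ~₁ y → (x <Φ y) ⇔ (x < y)
  <Φ⇔< x≁y = mk⇔ proj₁ (_, x≁y)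

  IsMinOf IsMaxOf : A → A → Set
  IsMinOf x m = x ~₁ m × ∀ {z} → x ~₁ z → ¬ z < m
  IsMaxOf x M = x ~₁ M × ∀ {z} → x ~₁ z → ¬ M < z

  Unbounded : A → Set
  Unbounded x = ∀ {z} → x ~₁ z → ∃ λ w → x ~₁ w × z < w

  module _ {T : Set} {_<T_ : Rel T 0ℓ} where

    order-embedding-injective : Trichotomous _≡_ _<T_ → ∀ {g : T → A} {t t'} →
      (t <T t' → g t < g t') → (t' <T t → g t' < g t) → g t ≡ g t' → t ≡ t'
    order-embedding-injective cmp {t = t} {t'} mono mono' e with cmp t t'
    ... | tri< t<t' _ _ = ⊥-elim (irrefl e (mono t<t'))
    ... | tri≈ _ t≡t' _ = t≡t'
    ... | tri> _ _ t'<t = ⊥-elim (irrefl (sym e) (mono' t'<t))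

    mkOrderIso : Trichotomous _≡_ _<T_ → (B : A → Set) (g : T → A) →
                 (∀ t → B (g t)) → (∀ a → B a → ∃ λ t → g t ≡ a) →
                 (∀ {t t'} → t <T t' → g t < g t') → OrderIso _<_ B T _<T_
    mkOrderIso cmp B g into onto mono = g , into , onto , λ t t' → mk⇔ mono (reflect t t')
      where
      reflect : ∀ t t' → g t < g t' → t <T t'
      reflect t t' gt<gt' with cmp t t'
      ... | tri< t<t' _ _ = t<t'
      ... | tri≈ _ refl _ = ⊥-elim (irrefl refl gt<gt')
      ... | tri> _ _ t'<t = ⊥-elim (asym gt<gt' (mono t'<t))

    orderIsoᵒᵖ : ∀ {x} → OrderIso (flip _<_) (Op.Block x) T _<T_ → OrderIso _<_ (Block x) T (flip _<T_)
    orderIsoᵒᵖ (g , into , onto , ord) =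
      g , (to ~₁ᵒᵖ⇔~₁ ∘ into) , (λ a x~a → onto a (from ~₁ᵒᵖ⇔~₁ x~a)) , λ t t' → ord t' t

  record BlockIso (r r' : A) (h : A → A) : Set where
    field
      into  : ∀ {y} → r ~₁ y → r' ~₁ h y
      onto  : ∀ {y'} → r' ~₁ y' → ∃ λ y → r ~₁ y × h y ≡ y'
      order : ∀ {y z} → r ~₁ y → r ~₁ z → (y < z) ⇔ (h y < h z)

  module _ {r r' h} (iso : BlockIso r r' h) where
    open BlockIso iso

    blockIso-injective : ∀ {y z} → r ~₁ y → r ~₁ z → h y ≡ h z → y ≡ z
    blockIso-injective r~y r~z = order-embedding-injective compare (to (order r~y r~z)) (to (order r~z r~y))

    blockIso-resp-~₁ : ∀ {r''} → r' ~₁ r'' → BlockIso r r'' h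
    blockIso-resp-~₁ r'~r'' = record
      { into  = ~₁-trans (~₁-sym r'~r'') ∘ into
      ; onto  = onto ∘ ~₁-trans r'~r''
      ; order = order
      }

    blockIso-immSucc : ∀ {y y'} → r ~₁ y → r ~₁ y' → IsImmSucc y y' ⇔ IsImmSucc (h y) (h y')
    blockIso-immSucc {y} {y'} r~y r~y' = mk⇔ forth back
      where
      forth : IsImmSucc y y' → IsImmSucc (h y) (h y')
      forth (y<y' , gap) = to (order r~y r~y') y<y' , λ w (hy<w , w<hy') →
        let hy~hy' = ~₁-trans (~₁-sym (into r~y)) (into r~y')
            (v , r~v , hv≡w) = onto (~₁-trans (into r~y) (proj₁ (~₁-convex hy<w w<hy' hy~hy')))
        in gap v ( from (order r~y r~v) (subst (h y <_) (sym hv≡w) hy<w)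
                 , from (order r~v r~y') (subst (_< h y') (sym hv≡w) w<hy'))
      back : IsImmSucc (h y) (h y') → IsImmSucc y y'
      back (hy<hy' , gap) = from (order r~y r~y') hy<hy' , λ v (y<v , v<y') →
        let r~v = ~₁-trans r~y (proj₁ (~₁-convex y<v v<y' (~₁-trans (~₁-sym r~y) r~y')))
        in gap (h v) (to (order r~y r~v) y<v , to (order r~v r~y') v<y')

    module _ {T : Set} {_<T_ : Rel T 0ℓ} where

      push-orderIso : OrderIso _<_ (Block r) T _<T_ → OrderIso _<_ (Block r') T _<T_
      push-orderIso (g , into-g , onto-g , ord) = h ∘ g , into ∘ into-g , onto-hg , ord-hg
        where
        onto-hg : ∀ a' → r' ~₁ a' → ∃ λ t → h (g t) ≡ a'
        onto-hg a' r'~a' =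
          let (a , r~a , ha≡a') = onto r'~a'
              (t , gt≡a) = onto-g a r~a
          in t , trans (cong h gt≡a) ha≡a'
        ord-hg : ∀ t t' → (t <T t') ⇔ (h (g t) < h (g t'))
        ord-hg t t' = ⇔.trans (ord t t') (order (into-g t) (into-g t'))

      pull-orderIso : OrderIso _<_ (Block r') T _<T_ → OrderIso _<_ (Block r) T _<T_
      pull-orderIso (g' , into-g' , onto-g' , ord') = g , r~g , onto-g , ord
        where
        g : T → A
        g t = proj₁ (onto (into-g' t))
        r~g : ∀ t → r ~₁ g t
        r~g t = proj₁ (proj₂ (onto (into-g' t)))
        hg≡g' : ∀ t → h (g t) ≡ g' t
        hg≡g' t = proj₂ (proj₂ (onto (into-g' t)))
        onto-g : ∀ a → r ~₁ a → ∃ λ t → g t ≡ a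
        onto-g a r~a =
          let (t , g't≡ha) = onto-g' (h a) (into r~a)
          in t , blockIso-injective (r~g t) r~a (trans (hg≡g' t) g't≡ha)
        ord : ∀ t t' → (t <T t') ⇔ (g t < g t')
        ord t t' = ⇔.trans (ord' t t')
          (⇔.sym (subst₂ (λ u u' → (g t < g t') ⇔ (u < u')) (hg≡g' t) (hg≡g' t') (order (r~g t) (r~g t'))))

  SameColour : A → A → Set
  SameColour r r' = (colW r ⇔ colW r') × (colZ r ⇔ colZ r') × (colSW r ⇔ colSW r') ×
                    (∀ n → colC (suc n) r ⇔ colC (suc n) r')

  blockIso⇒sameColour : ∀ {r r' h} → BlockIso r r' h → SameColour r r'
  blockIso⇒sameColour {r} {r'} iso = same , same , same , λ _ → same
    where
    same : ∀ {T _<T_} → OrderIso _<_ (Block r) T _<T_ ⇔ OrderIso _<_ (Block r') T _<T_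
    same = mk⇔ (push-orderIso iso) (pull-orderIso iso)

module Climbing (em : ExcludedMiddle 0ℓ) {A : Set} {_≺_ : Rel A 0ℓ} (sto : IsStrictTotalOrder _≡_ _≺_)
                (σ : A → A)
                (σ-immSucc : ∀ {x y} → LO.IsImmSucc _≺_ x y → σ x ≡ y)
                (σ-fixed : ∀ {x} → ¬ (∃ λ y → LO.IsImmSucc _≺_ x y) → σ x ≡ x) where
  open LO _≺_
  open IsStrictTotalOrder sto renaming (trans to ≺-trans)
  open Blocks sto

  σ^ : ℕ → A → A
  σ^ n x = iterate σ x n

  σ-~₁ : ∀ x → x ~₁ σ x
  σ-~₁ x with em {∃ λ y → IsImmSucc x y}
  ... | yes (y , x⋖y) = subst (x ~₁_) (sym (σ-immSucc x⋖y)) (immSucc⇒~₁ x⋖y)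
  ... | no ∄ = ~₁-reflexive (sym (σ-fixed ∄))

  σ^-~₁ : ∀ n x → x ~₁ σ^ n x
  σ^-~₁ zero x = ~₁-refl
  σ^-~₁ (suc n) x = ~₁-trans (σ-~₁ x) (σ^-~₁ n (σ x))

  infixr 5 _∷_
  data Ascent : ℕ → A → A → Set where
    []  : ∀ {x} → Ascent 0 x x
    _∷_ : ∀ {n x y} → x ≺ σ x → Ascent n (σ x) y → Ascent (suc n) x y

  ascent-end : ∀ {n x y} → Ascent n x y → σ^ n x ≡ y
  ascent-end [] = refl
  ascent-end (_ ∷ a) = ascent-end a

  _++ᴬ_ : ∀ {m n x y z} → Ascent m x y → Ascent n y z → Ascent (m + n) x z
  [] ++ᴬ b = b
  (x≺σx ∷ a) ++ᴬ b = x≺σx ∷ (a ++ᴬ b)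

  ascent-mono : ∀ {n x y i j} → Ascent n x y → i ℕ.< j → j ℕ.≤ n → σ^ i x ≺ σ^ j x
  ascent-mono {i = zero}  {suc zero}    (x≺σx ∷ _) _ _ = x≺σx
  ascent-mono {i = zero}  {suc (suc j)} (x≺σx ∷ a) _ (s≤s j<n) =
    ≺-trans x≺σx (ascent-mono a (s≤s z≤n) j<n)
  ascent-mono {i = suc i} {suc j}       (_ ∷ a) (s≤s i<j) (s≤s j≤n) = ascent-mono a i<j j≤n

  immSucc⇒ascent : ∀ {x y} → IsImmSucc x y → Ascent 1 x y
  immSucc⇒ascent {x} x⋖y@(x≺y , _) = subst (Ascent 1 x) σx≡y (subst (x ≺_) (sym σx≡y) x≺y ∷ [])
    where σx≡y = σ-immSucc x⋖y

  -- Induction on a list covering the open interval: an element of the list lying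
  -- inside the interval splits it into two intervals covered by the tail.
  ascent-covered : ∀ xs {x y} → x ≺ y → (∀ {z} → x ≺ z → z ≺ y → z ∈ xs) →
                   ∃ λ n → Ascent n x y
  ascent-covered [] x≺y cover =
    1 , immSucc⇒ascent (x≺y , λ z (x≺z , z≺y) → contradiction (cover x≺z z≺y) λ ())
  ascent-covered (a ∷ xs) {x} {y} x≺y cover with em {x ≺ a × a ≺ y}
  ... | yes (x≺a , a≺y) =
        let (m , x↑a) = ascent-covered xs x≺a left
            (n , a↑y) = ascent-covered xs a≺y right
        in m + n , x↑a ++ᴬ a↑y
    where
    left : ∀ {z} → x ≺ z → z ≺ a → z ∈ xs
    left x≺z z≺a = Any.tail (λ z≡a → irrefl z≡a z≺a) (cover x≺z (≺-trans z≺a a≺y))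
    right : ∀ {z} → a ≺ z → z ≺ y → z ∈ xs
    right a≺z z≺y = Any.tail (λ z≡a → irrefl (sym z≡a) a≺z) (cover (≺-trans x≺a a≺z) z≺y)
  ... | no a∉ = ascent-covered xs x≺y λ x≺z z≺y →
        Any.tail (λ { refl → a∉ (x≺z , z≺y) }) (cover x≺z z≺y)

  ~₁⇒ascent : ∀ {x y} → x ≺ y → x ~₁ y → ∃ λ n → Ascent n x y
  ~₁⇒ascent x≺y (xs , cover) = ascent-covered xs x≺y λ x≺z z≺y → cover _ (inj₁ (x≺z , z≺y))

  ~₁⇒≺σ : ∀ {x y} → x ≺ y → x ~₁ y → x ≺ σ x
  ~₁⇒≺σ x≺y x~y with ~₁⇒ascent x≺y x~y
  ... | zero , [] = ⊥-elim (irrefl refl x≺y)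
  ... | suc _ , x≺σx ∷ _ = x≺σx

  unbounded-ascent : ∀ {r x} → Unbounded r → r ~₁ x → ∀ n → Ascent n x (σ^ n x)
  unbounded-ascent U r~x zero = []
  unbounded-ascent {r} {x} U r~x (suc n) = x≺σx ∷ unbounded-ascent U (~₁-trans r~x (σ-~₁ x)) n
    where
    x≺σx : x ≺ σ x
    x≺σx = let (w , r~w , x≺w) = U r~x in ~₁⇒≺σ x≺w (~₁-trans (~₁-sym r~x) r~w)

  ascent-from-min : ∀ {x m a} → IsMinOf x m → x ~₁ a → ∃ λ n → Ascent n m a
  ascent-from-min {m = m} {a} (x~m , minimal) x~a with compare m a
  ... | tri< m≺a _ _ = ~₁⇒ascent m≺a (~₁-trans (~₁-sym x~m) x~a)
  ... | tri≈ _ refl _ = 0 , []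
  ... | tri> _ _ a≺m = ⊥-elim (minimal x~a a≺m)

  ωBlock : ∀ {x m} → IsMinOf x m → Unbounded x → OrderIso _≺_ (Block x) ℕ ℕ._<_
  ωBlock {x} {m} min@(x~m , _) U =
    mkOrderIso ℕₚ.<-cmp (Block x) (λ n → σ^ n m) (λ n → ~₁-trans x~m (σ^-~₁ n m)) onto mono
    where
    onto : ∀ a → x ~₁ a → ∃ λ n → σ^ n m ≡ a
    onto a x~a = Product.map₂ ascent-end (ascent-from-min min x~a)
    mono : ∀ {i j} → i ℕ.< j → σ^ i m ≺ σ^ j m
    mono {j = j} i<j = ascent-mono (unbounded-ascent U x~m j) i<j ℕₚ.≤-refl

  finBlock : ∀ {x m M} → IsMinOf x m → IsMaxOf x M → ∃ λ N → OrderIso _≺_ (Block x) (Fin (suc N)) Fin._<_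
  finBlock {x} {m} {M} min@(x~m , _) (x~M , maximal) =
    N , mkOrderIso Finₚ.<-cmp (Block x) g (λ k → ~₁-trans x~m (σ^-~₁ (toℕ k) m)) onto mono
    where
    N = proj₁ (ascent-from-min min x~M)
    m↑M = proj₂ (ascent-from-min min x~M)
    g : Fin (suc N) → A
    g k = σ^ (toℕ k) m
    onto : ∀ a → x ~₁ a → ∃ λ k → g k ≡ a
    onto a x~a with ascent-from-min min x~a
    ... | n , m↑a with n ℕ.≤? N
    ...   | yes n≤N = fromℕ< (s≤s n≤N) ,
                      trans (cong (λ k → σ^ k m) (Finₚ.toℕ-fromℕ< (s≤s n≤N))) (ascent-end m↑a)
    ...   | no n≰N = ⊥-elim (maximal x~a (subst₂ _≺_ (ascent-end m↑M) (ascent-end m↑a)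
                                                   (ascent-mono m↑a (ℕₚ.≰⇒> n≰N) ℕₚ.≤-refl)))
    mono : ∀ {k k'} → k Fin.< k' → g k ≺ g k'
    mono {k' = k'} k<k' = ascent-mono m↑M k<k' (ℕₚ.≤-pred (Finₚ.toℕ<n k'))

  blockIso-commutes : ∀ {r r' h y} → BlockIso r r' h → r ~₁ y → h (σ y) ≡ σ (h y)
  blockIso-commutes {h = h} {y} iso r~y with em {∃ λ y' → IsImmSucc y y'}
  ... | yes (y' , y⋖y') =
        trans (cong h (σ-immSucc y⋖y')) (sym (σ-immSucc (to (blockIso-immSucc iso r~y r~y') y⋖y')))
    where r~y' = ~₁-trans r~y (immSucc⇒~₁ y⋖y')
  ... | no ∄ = trans (cong h (σ-fixed ∄)) (sym (σ-fixed ∄'))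
    where
    open BlockIso iso
    ∄' : ¬ (∃ λ u → IsImmSucc (h y) u)
    ∄' (u , hy⋖u) =
      let (v , r~v , hv≡u) = onto (~₁-trans (into r~y) (immSucc⇒~₁ hy⋖u))
      in ∄ (v , from (blockIso-immSucc iso r~y r~v) (subst (IsImmSucc (h y)) (sym hv≡u) hy⋖u))

module Structure (em : ExcludedMiddle 0ℓ) {A : Set} {_<_ : Rel A 0ℓ} (sto : IsStrictTotalOrder _≡_ _<_) where
  open LO _<_
  open LO.WithEM _<_ em
  open IsStrictTotalOrder sto renaming (trans to <-trans)
  open Blocks sto

  private
    stoᵒᵖ : IsStrictTotalOrder _≡_ (flip _<_)
    stoᵒᵖ = Flip.isStrictTotalOrder sto
    module Op = LO (flip _<_)
    module Opᴮ = Blocks stoᵒᵖ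

  s-immSucc : ∀ {x y} → IsImmSucc x y → s x ≡ y
  s-immSucc {x} x⋖y with em {∃ λ y → IsImmSucc x y}
  ... | yes (_ , x⋖y') = immSucc-unique x⋖y' x⋖y
  ... | no ∄ = contradiction (_ , x⋖y) ∄

  s-fixed : ∀ {x} → ¬ (∃ λ y → IsImmSucc x y) → s x ≡ x
  s-fixed {x} ∄ with em {∃ λ y → IsImmSucc x y}
  ... | yes ∃y = contradiction ∃y ∄
  ... | no _ = refl

  p-immSucc : ∀ {x y} → Op.IsImmSucc x y → p x ≡ y
  p-immSucc {x} x⋗y with em {∃ λ y → IsImmSucc y x}
  ... | yes (_ , y'⋖x) = Opᴮ.immSucc-unique (from immSuccᵒᵖ⇔immSucc y'⋖x) x⋗y
  ... | no ∄ = contradiction (_ , to immSuccᵒᵖ⇔immSucc x⋗y) ∄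

  p-fixed : ∀ {x} → ¬ (∃ λ y → Op.IsImmSucc x y) → p x ≡ x
  p-fixed {x} ∄ with em {∃ λ y → IsImmSucc y x}
  ... | yes (y , y⋖x) = contradiction (y , from immSuccᵒᵖ⇔immSucc y⋖x) ∄
  ... | no _ = refl

  -- p is the s of the reversed order, so everything proved about s holds for p.
  module S = Climbing em sto s s-immSucc s-fixed
  module P = Climbing em stoᵒᵖ p p-immSucc p-fixed

  s-~₁ : ∀ x → x ~₁ s x
  s-~₁ = S.σ-~₁

  p-~₁ : ∀ x → x ~₁ p x
  p-~₁ x = to ~₁ᵒᵖ⇔~₁ (P.σ-~₁ x)

  blockIsoᵒᵖ : ∀ {r r' h} → BlockIso r r' h → Opᴮ.BlockIso r r' h
  blockIsoᵒᵖ iso = record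
    { into  = from ~₁ᵒᵖ⇔~₁ ∘ into ∘ to ~₁ᵒᵖ⇔~₁
    ; onto  = Product.map₂ (Product.map₁ (from ~₁ᵒᵖ⇔~₁)) ∘ onto ∘ to ~₁ᵒᵖ⇔~₁
    ; order = λ r~y r~z → order (to ~₁ᵒᵖ⇔~₁ r~z) (to ~₁ᵒᵖ⇔~₁ r~y)
    }
    where open BlockIso iso

  blockIso-commutes-s : ∀ {r r' h y} → BlockIso r r' h → r ~₁ y → h (s y) ≡ s (h y)
  blockIso-commutes-s = S.blockIso-commutes

  blockIso-commutes-p : ∀ {r r' h y} → BlockIso r r' h → r ~₁ y → h (p y) ≡ p (h y)
  blockIso-commutes-p iso r~y = P.blockIso-commutes (blockIsoᵒᵖ iso) (from ~₁ᵒᵖ⇔~₁ r~y)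

  reach⇒~₁ : ∀ {g z} → Reach g z → g ~₁ z
  reach⇒~₁ here = ~₁-refl
  reach⇒~₁ (stepS {y} r) = ~₁-trans (reach⇒~₁ r) (s-~₁ y)
  reach⇒~₁ (stepP {y} r) = ~₁-trans (reach⇒~₁ r) (p-~₁ y)

  reach-s^ : ∀ {g y} → Reach g y → ∀ n → Reach g (S.σ^ n y)
  reach-s^ r zero = r
  reach-s^ r (suc n) = reach-s^ (stepS r) n

  reach-p^ : ∀ {g y} → Reach g y → ∀ n → Reach g (P.σ^ n y)
  reach-p^ r zero = r
  reach-p^ r (suc n) = reach-p^ (stepP r) n

  ~₁⇒reach : ∀ {g z} → g ~₁ z → Reach g z
  ~₁⇒reach {g} {z} g~z with compare g z
  ... | tri< g<z _ _ = let (n , g↑z) = S.~₁⇒ascent g<z g~z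
                       in subst (Reach g) (S.ascent-end g↑z) (reach-s^ here n)
  ... | tri≈ _ refl _ = here
  ... | tri> _ _ z<g = let (n , g↓z) = P.~₁⇒ascent z<g (from ~₁ᵒᵖ⇔~₁ g~z)
                       in subst (Reach g) (P.ascent-end g↓z) (reach-p^ here n)

  gen⇒inDom : ∀ {gs z} → Gen gs z → InDom gs z
  gen⇒inDom (g , g∈gs , g↝z) = g , g∈gs , ~₁-sym (reach⇒~₁ g↝z)

  inDom⇒gen : ∀ {gs z} → InDom gs z → Gen gs z
  inDom⇒gen (g , g∈gs , z~g) = g , g∈gs , ~₁⇒reach (~₁-sym z~g)

  inDom-resp-~₁ : ∀ {gs y z} → InDom gs y → y ~₁ z → InDom gs z
  inDom-resp-~₁ (g , g∈gs , y~g) y~z = g , g∈gs , ~₁-trans (~₁-sym y~z) y~g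

  gen-s : ∀ {gs y} → Gen gs y → Gen gs (s y)
  gen-s = Product.map₂ (Product.map₂ stepS)

  gen-p : ∀ {gs y} → Gen gs y → Gen gs (p y)
  gen-p = Product.map₂ (Product.map₂ stepP)

  HasMin HasMax : A → Set
  HasMin x = ∃ (IsMinOf x)
  HasMax x = ∃ (IsMaxOf x)

  ¬HasMax⇒unbounded : ∀ {x} → ¬ HasMax x → Unbounded x
  ¬HasMax⇒unbounded {x} ∄max {z} x~z with em {∃ λ w → x ~₁ w × z < w}
  ... | yes above = above
  ... | no ∄above = contradiction (z , x~z , λ {_} x~w z<w → ∄above (_ , x~w , z<w)) ∄max

  ¬HasMin⇒unboundedᵒᵖ : ∀ {x} → ¬ HasMin x → Opᴮ.Unbounded x
  ¬HasMin⇒unboundedᵒᵖ {x} ∄min {z} x~z with em {∃ λ w → x ~₁ w × w < z}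
  ... | yes (w , x~w , w<z) = w , from ~₁ᵒᵖ⇔~₁ x~w , w<z
  ... | no ∄below = contradiction (z , to ~₁ᵒᵖ⇔~₁ x~z , λ {_} x~w w<z → ∄below (_ , x~w , w<z)) ∄min

  maxᵒᵖ : ∀ {x M} → IsMaxOf x M → Opᴮ.IsMinOf x M
  maxᵒᵖ (x~M , maximal) = from ~₁ᵒᵖ⇔~₁ x~M , maximal ∘ to ~₁ᵒᵖ⇔~₁

  ζBlock : ∀ {x} → ¬ HasMin x → ¬ HasMax x → colZ x
  ζBlock {x} ∄min ∄max = mkOrderIso ℤₚ.<-cmp (Block x) g into onto mono
    where
    up : ∀ n → S.Ascent n x (S.σ^ n x)
    up = S.unbounded-ascent (¬HasMax⇒unbounded ∄max) ~₁-refl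
    down : ∀ n → P.Ascent n x (P.σ^ n x)
    down = P.unbounded-ascent (¬HasMin⇒unboundedᵒᵖ ∄min) Opᴮ.~₁-refl
    g : ℤ → A
    g (+ n) = S.σ^ n x
    g -[1+ n ] = P.σ^ (suc n) x
    into : ∀ i → x ~₁ g i
    into (+ n) = S.σ^-~₁ n x
    into -[1+ n ] = to ~₁ᵒᵖ⇔~₁ (P.σ^-~₁ (suc n) x)
    onto : ∀ a → x ~₁ a → ∃ λ i → g i ≡ a
    onto a x~a with compare x a
    ... | tri< x<a _ _ = Product.map +_ S.ascent-end (S.~₁⇒ascent x<a x~a)
    ... | tri≈ _ refl _ = + 0 , refl
    ... | tri> _ _ a<x with P.~₁⇒ascent a<x (from ~₁ᵒᵖ⇔~₁ x~a)
    ...   | zero , P.[] = ⊥-elim (irrefl refl a<x)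
    ...   | suc n , x↓a = -[1+ n ] , P.ascent-end x↓a
    below : ∀ m → P.σ^ (suc m) x < x
    below m = P.ascent-mono (down (suc m)) (s≤s z≤n) ℕₚ.≤-refl
    mono : ∀ {i j} → i ℤ.< j → g i < g j
    mono (ℤ.-<- n<m) = P.ascent-mono (down _) (s≤s n<m) ℕₚ.≤-refl
    mono (ℤ.-<+ {m} {zero}) = below m
    mono (ℤ.-<+ {m} {suc n}) = <-trans (below m) (S.ascent-mono (up (suc n)) (s≤s z≤n) ℕₚ.≤-refl)
    mono (ℤ.+<+ m<n) = S.ascent-mono (up _) m<n ℕₚ.≤-refl

  blockType : ∀ x → colW x ⊎ colZ x ⊎ colSW x ⊎ ∃ λ n → colC (suc n) x
  blockType x with em {HasMin x} | em {HasMax x}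
  ... | yes (_ , min) | no ∄max    = inj₁ (S.ωBlock min (¬HasMax⇒unbounded ∄max))
  ... | no ∄min       | no ∄max    = inj₂ (inj₁ (ζBlock ∄min ∄max))
  ... | no ∄min       | yes (_ , max) =
        inj₂ (inj₂ (inj₁ (orderIsoᵒᵖ (P.ωBlock (maxᵒᵖ max) (¬HasMin⇒unboundedᵒᵖ ∄min)))))
  ... | yes (_ , min) | yes (_ , max) = inj₂ (inj₂ (inj₂ (S.finBlock min max)))

  orderIsos⇒blockIso : ∀ {r r' T} {_<T_ : Rel T 0ℓ} → Trichotomous _≡_ _<T_ →
    OrderIso _<_ (Block r) T _<T_ → OrderIso _<_ (Block r') T _<T_ → Σ (A → A) (BlockIso r r')
  orderIsos⇒blockIso {r} {r'} {_<T_ = _<T_} cmp (g , into-g , onto-g , ord) (g' , into-g' , onto-g' , ord') =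
    h , record { into = into ; onto = onto ; order = order }
    where
    h : A → A
    h y with em {r ~₁ y}
    ... | yes r~y = g' (proj₁ (onto-g y r~y))
    ... | no _ = y
    index : ∀ {y} → r ~₁ y → ∃ λ t → g t ≡ y × h y ≡ g' t
    index {y} r~y with em {r ~₁ y}
    ... | yes r~y' = proj₁ (onto-g y r~y') , proj₂ (onto-g y r~y') , refl
    ... | no r≁y = contradiction r~y r≁y
    into : ∀ {y} → r ~₁ y → r' ~₁ h y
    into r~y = let (t , _ , hy≡g't) = index r~y in subst (r' ~₁_) (sym hy≡g't) (into-g' t)
    onto : ∀ {y'} → r' ~₁ y' → ∃ λ y → r ~₁ y × h y ≡ y'
    onto {y'} r'~y' =
      let (t' , g't'≡y') = onto-g' y' r'~y'
          (t , gt≡gt' , e) = index (into-g t')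
          t≡t' = order-embedding-injective cmp {g = g} (to (ord t t')) (to (ord t' t)) gt≡gt'
      in g t' , into-g t' , trans e (trans (cong g' t≡t') g't'≡y')
    order : ∀ {y z} → r ~₁ y → r ~₁ z → (y < z) ⇔ (h y < h z)
    order r~y r~z with index r~y | index r~z
    ... | t , refl , hy≡ | u , refl , hz≡ =
      subst₂ (λ a b → (g t < g u) ⇔ (a < b)) (sym hy≡) (sym hz≡) (⇔.trans (⇔.sym (ord t u)) (ord' t u))

  sameColour⇒blockIso : ∀ {r r'} → SameColour r r' → Σ (A → A) (BlockIso r r')
  sameColour⇒blockIso {r} (w , z , sw , c) with blockType r
  ... | inj₁ I = orderIsos⇒blockIso ℕₚ.<-cmp I (to w I)
  ... | inj₂ (inj₁ I) = orderIsos⇒blockIso ℤₚ.<-cmp I (to z I)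
  ... | inj₂ (inj₂ (inj₁ I)) = orderIsos⇒blockIso (Flip.compare _ ℕₚ.<-cmp) I (to sw I)
  ... | inj₂ (inj₂ (inj₂ (n , I))) = orderIsos⇒blockIso Finₚ.<-cmp I (to (c n) I)

  module PartialLSPIso (D : A → Set) (D-s : ∀ {x} → D x → D (s x)) (D-p : ∀ {x} → D x → D (p x))
                       (f : A → A) (f-< : ∀ {x y} → D x → D y → (x < y) ⇔ (f x < f y))
                       (f-s : ∀ {x} → D x → f (s x) ≡ s (f x))
                       (f-p : ∀ {x} → D x → f (p x) ≡ p (f x)) where

    D-reach : ∀ {x y} → D x → Reach x y → D y
    D-reach dx here = dx
    D-reach dx (stepS r) = D-s (D-reach dx r)
    D-reach dx (stepP r) = D-p (D-reach dx r)

    map-reach : ∀ {x y} → D x → Reach x y → Reach (f x) (f y)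
    map-reach dx here = here
    map-reach dx (stepS r) = subst (Reach _) (sym (f-s (D-reach dx r))) (stepS (map-reach dx r))
    map-reach dx (stepP r) = subst (Reach _) (sym (f-p (D-reach dx r))) (stepP (map-reach dx r))

    lift-reach : ∀ {x w} → D x → Reach (f x) w → ∃ λ y → Reach x y × f y ≡ w
    lift-reach {x} dx here = x , here , refl
    lift-reach dx (stepS r) with lift-reach dx r
    ... | y , x↝y , refl = s y , stepS x↝y , f-s (D-reach dx x↝y)
    lift-reach dx (stepP r) with lift-reach dx r
    ... | y , x↝y , refl = p y , stepP x↝y , f-p (D-reach dx x↝y)

    f-injective : ∀ {x y} → D x → D y → f x ≡ f y → x ≡ y
    f-injective dx dy = order-embedding-injective compare (to (f-< dx dy)) (to (f-< dy dx))

    f-~₁ : ∀ {x y} → D x → D y → (x ~₁ y) ⇔ (f x ~₁ f y)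
    f-~₁ {x} {y} dx dy = mk⇔ (reach⇒~₁ ∘ map-reach dx ∘ ~₁⇒reach) reflect
      where
      reflect : f x ~₁ f y → x ~₁ y
      reflect fx~fy =
        let (w , x↝w , fw≡fy) = lift-reach dx (~₁⇒reach fx~fy)
        in subst (x ~₁_) (f-injective (D-reach dx x↝w) dy fw≡fy) (reach⇒~₁ x↝w)

    f-<Φ : ∀ {x y} → D x → D y → (x <Φ y) ⇔ (f x <Φ f y)
    f-<Φ dx dy = mk⇔ (Product.map (to (f-< dx dy)) (λ x≁y → x≁y ∘ from (f-~₁ dx dy)))
                     (Product.map (from (f-< dx dy)) (λ fx≁fy → fx≁fy ∘ to (f-~₁ dx dy)))

    f-blockIso : ∀ {r} → D r → BlockIso r (f r) f
    f-blockIso dr = record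
      { into  = λ r~y → to (f-~₁ dr (D-at r~y)) r~y
      ; onto  = λ fr~y' → Product.map₂ (Product.map₁ reach⇒~₁) (lift-reach dr (~₁⇒reach fr~y'))
      ; order = λ r~y r~z → f-< (D-at r~y) (D-at r~z)
      }
      where
      D-at : ∀ {y} → _ ~₁ y → D y
      D-at = D-reach dr ∘ ~₁⇒reach

  autLSP⇒autΦ : ∀ {σ} → AutLSP σ → AutΦ σ
  autLSP⇒autΦ {σ} (_ , σ-onto , σ-< , σ-s , σ-p) =
    (λ _ _ → f-~₁ tt tt) , Product.map₂ ~₁-reflexive ∘ σ-onto , (λ _ _ → f-<Φ tt tt) ,
    λ _ → blockIso⇒sameColour (f-blockIso tt)
    where
    open PartialLSPIso (λ _ → ⊤) id id σ (λ {x} {y} _ _ → σ-< x y) (λ _ → σ-s _) (λ _ → σ-p _)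

  partIsoLSP⇒partIsoΦ : ∀ {gs hs f} → PartIsoLSP gs hs f → PartIsoΦ gs hs f
  partIsoLSP⇒partIsoΦ {gs} {hs} {f} (f-into , f-onto , f-< , f-s , f-p) =
    (λ z → gen⇒inDom ∘ f-into z ∘ inDom⇒gen) ,
    (λ y dy → let (x , gx , fx≡y) = f-onto y (inDom⇒gen dy) in x , gen⇒inDom gx , ~₁-reflexive fx≡y) ,
    (λ _ _ dz dz' → f-~₁ (inDom⇒gen dz) (inDom⇒gen dz')) ,
    (λ _ _ dz dz' → f-<Φ (inDom⇒gen dz) (inDom⇒gen dz')) ,
    λ _ dz → blockIso⇒sameColour (f-blockIso (inDom⇒gen dz))
    where
    open PartialLSPIso (Gen gs) gen-s gen-p f (λ {x} {y} → f-< x y) (f-s _) (f-p _)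

  -- The element of least code is a canonical representative of its block, so that glue
  -- applies a single block isomorphism to each whole block; this is the only use of
  -- countability.
  module Representatives (cnt : Countable A) where
    private
      code = proj₁ cnt
      CodeInBlock : A → ℕ → Set
      CodeInBlock y n = ∃ λ a → code a ≡ n × y ~₁ a
      least-code : ∀ y → ∃ λ k → CodeInBlock y k × ∀ {j} → CodeInBlock y j → k ℕ.≤ j
      least-code y = least-witness em (CodeInBlock y) (y , refl , ~₁-refl)

    rep : A → A
    rep y = proj₁ (proj₁ (proj₂ (least-code y)))

    rep-~₁ : ∀ y → y ~₁ rep y
    rep-~₁ y = proj₂ (proj₂ (proj₁ (proj₂ (least-code y))))

    rep-cong : ∀ {y z} → y ~₁ z → rep y ≡ rep z
    rep-cong {y} {z} y~z with least-code y | least-code z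
    ... | _ , (a , refl , y~a) , a-least | _ , (b , refl , z~b) , b-least =
      proj₂ cnt (ℕₚ.≤-antisym (a-least (b , refl , ~₁-trans y~z z~b))
                              (b-least (a , refl , ~₁-trans (~₁-sym y~z) y~a)))

    module Glue (D : A → Set) (D-resp : ∀ {y z} → D y → y ~₁ z → D z) (ρ : A → A)
                (ρ-~₁ : ∀ {y z} → D y → D z → (y ~₁ z) ⇔ (ρ y ~₁ ρ z))
                (ρ-<Φ : ∀ {y z} → D y → D z → (y <Φ z) ⇔ (ρ y <Φ ρ z))
                (H : A → A → A) (H-iso : ∀ {r} → D r → BlockIso r (ρ r) (H r)) where

      glue : A → A
      glue y = H (rep y) y

      private
        iso-at : ∀ {y} → D y → BlockIso (rep y) (ρ (rep y)) (H (rep y))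
        iso-at {y} dy = H-iso (D-resp dy (rep-~₁ y))

        ρ-rep : ∀ {y} → D y → ρ (rep y) ~₁ ρ y
        ρ-rep {y} dy = to (ρ-~₁ (D-resp dy (rep-~₁ y)) dy) (~₁-sym (rep-~₁ y))

      glue-~₁ : ∀ {y} → D y → glue y ~₁ ρ y
      glue-~₁ {y} dy = ~₁-trans (~₁-sym (BlockIso.into (iso-at dy) (~₁-sym (rep-~₁ y)))) (ρ-rep dy)

      glue-< : ∀ {y z} → D y → D z → (y < z) ⇔ (glue y < glue z)
      glue-< {y} {z} dy dz with em {y ~₁ z}
      ... | yes y~z = subst (λ w → (y < z) ⇔ (glue y < w)) (cong (λ r → H r z) (rep-cong y~z))
                        (BlockIso.order (iso-at dy) (~₁-sym (rep-~₁ y)) (~₁-trans (~₁-sym (rep-~₁ y)) y~z))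
      ... | no y≁z =
        ⇔.trans (⇔.sym (<Φ⇔< y≁z)) (⇔.trans (ρ-<Φ dy dz)
          (⇔.trans (<Φ-cong (~₁-sym (glue-~₁ dy)) (~₁-sym (glue-~₁ dz))) (<Φ⇔< glue-≁)))
        where
        glue-≁ : ¬ glue y ~₁ glue z
        glue-≁ gy~gz =
          y≁z (from (ρ-~₁ dy dz) (~₁-trans (~₁-sym (glue-~₁ dy)) (~₁-trans gy~gz (glue-~₁ dz))))

      glue-s : ∀ {y} → D y → glue (s y) ≡ s (glue y)
      glue-s {y} dy = trans (cong (λ r → H r (s y)) (rep-cong (~₁-sym (s-~₁ y))))
                            (blockIso-commutes-s (iso-at dy) (~₁-sym (rep-~₁ y)))

      glue-p : ∀ {y} → D y → glue (p y) ≡ p (glue y)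
      glue-p {y} dy = trans (cong (λ r → H r (p y)) (rep-cong (~₁-sym (p-~₁ y))))
                            (blockIso-commutes-p (iso-at dy) (~₁-sym (rep-~₁ y)))

      glue-onto : ∀ {z y'} → D z → ρ z ~₁ y' → ∃ λ y → D y × glue y ≡ y'
      glue-onto {z} dz ρz~y' =
        let (y , rz~y , e) = BlockIso.onto (iso-at dz) (~₁-trans (ρ-rep dz) ρz~y')
            z~y = ~₁-trans (rep-~₁ z) rz~y
        in y , D-resp dz z~y , trans (cong (λ r → H r y) (rep-cong (~₁-sym z~y))) e

    partIsoΦ⇒partIsoLSP : ∀ {xs ys f} → PartIsoΦ xs ys f →
      ∃ λ F → PartIsoLSP xs ys F × ∀ z → InDom xs z → F z ~₁ f z
    partIsoΦ⇒partIsoLSP {xs} {ys} {f} (f-into , f-onto , f-~₁ , f-<Φ , f-colour) =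
      glue , glue-partIso , λ _ → glue-~₁
      where
      H : A → A → A
      H r with em {SameColour r (f r)}
      ... | yes same = proj₁ (sameColour⇒blockIso same)
      ... | no _ = id
      H-iso : ∀ {r} → InDom xs r → BlockIso r (f r) (H r)
      H-iso {r} dr with em {SameColour r (f r)}
      ... | yes same = proj₂ (sameColour⇒blockIso same)
      ... | no differ = contradiction (f-colour r dr) differ
      open Glue (InDom xs) inDom-resp-~₁ f (λ {y} {z} → f-~₁ y z) (λ {y} {z} → f-<Φ y z) H H-iso
      glue-partIso : PartIsoLSP xs ys glue
      glue-partIso =
        (λ y gy → let dy = gen⇒inDom gy in inDom⇒gen (inDom-resp-~₁ (f-into y dy) (~₁-sym (glue-~₁ dy)))) ,
        (λ y' gy' → let (z , dz , fz~y') = f-onto y' (gen⇒inDom gy')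
                        (y , dy , e) = glue-onto dz fz~y'
                    in y , inDom⇒gen dy , e) ,
        (λ _ _ gy gz → glue-< (gen⇒inDom gy) (gen⇒inDom gz)) ,
        (λ _ → glue-s ∘ gen⇒inDom) ,
        (λ _ → glue-p ∘ gen⇒inDom)

    autΦ⇒autLSP : ∀ {gs hs f τ} → PartIsoLSP gs hs f → AutΦ τ → (∀ z → InDom gs z → τ z ~₁ f z) →
      ∃ λ σ → AutLSP σ × ∀ x → Gen gs x → σ x ≡ f x
    autΦ⇒autLSP {gs} {hs} {f} {τ} (_ , _ , f-< , f-s , f-p) (τ-~₁ , τ-onto , τ-<Φ , τ-colour) τ-ext =
      glue , glue-aut , glue-ext
      where
      open PartialLSPIso (Gen gs) gen-s gen-p f (λ {x} {y} → f-< x y) (f-s _) (f-p _)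
      H : A → A → A
      H r with em {Gen gs r}
      ... | yes _ = f
      ... | no _ = proj₁ (sameColour⇒blockIso (τ-colour r))
      H-iso : ∀ {r} → ⊤ → BlockIso r (τ r) (H r)
      H-iso {r} _ with em {Gen gs r}
      ... | yes gr = blockIso-resp-~₁ (f-blockIso gr) (~₁-sym (τ-ext r (gen⇒inDom gr)))
      ... | no _ = proj₂ (sameColour⇒blockIso (τ-colour r))
      open Glue (λ _ → ⊤) _ τ (λ {y} {z} _ _ → τ-~₁ y z) (λ {y} {z} _ _ → τ-<Φ y z) H H-iso
      glue-aut : AutLSP glue
      glue-aut =
        order-embedding-injective compare (to (glue-< tt tt)) (to (glue-< tt tt)) ,
        (λ y' → let (y , _ , e) = glue-onto tt (proj₂ (τ-onto y')) in y , e) ,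
        (λ _ _ → glue-< tt tt) ,
        (λ _ → glue-s tt) ,
        (λ _ → glue-p tt)
      glue-ext : ∀ x → Gen gs x → glue x ≡ f x
      glue-ext x gx with em {Gen gs (rep x)}
      ... | yes _ = refl
      ... | no ¬g = contradiction (inDom⇒gen (inDom-resp-~₁ (gen⇒inDom gx) (rep-~₁ x))) ¬g

    homogeneousLSP⇒homogeneousΦ : HomogeneousLSP → HomogeneousΦ
    homogeneousLSP⇒homogeneousΦ homLSP xs ys f f-iso =
      let (F , F-iso , F~f) = partIsoΦ⇒partIsoLSP f-iso
          (σ , σ-aut , σ-ext) = homLSP xs ys F F-iso
      in σ , autLSP⇒autΦ σ-aut , λ z dz → ~₁-trans (~₁-reflexive (σ-ext z (inDom⇒gen dz))) (F~f z dz)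

    homogeneousΦ⇒homogeneousLSP : HomogeneousΦ → HomogeneousLSP
    homogeneousΦ⇒homogeneousLSP homΦ gs hs f f-iso =
      let (τ , τ-aut , τ-ext) = homΦ gs hs f (partIsoLSP⇒partIsoΦ f-iso)
      in autΦ⇒autLSP f-iso τ-aut τ-ext

mainTheorem2 : (em : ExcludedMiddle 0ℓ) (A : Set) (_<_ : Rel A 0ℓ) →
    IsStrictTotalOrder _≡_ _<_ → Countable A →
    LO.WithEM.HomogeneousLSP _<_ em ⇔ LO.HomogeneousΦ _<_
mainTheorem2 em A _<_ sto cnt = mk⇔ homogeneousLSP⇒homogeneousΦ homogeneousΦ⇒homogeneousLSP
  where open Structure em sto
        open Representatives cnt
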